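{- Two $\mathcal{A}$-trees $T_1,T_2$ are ancestrally compatible if and only if they have a common weak $\mathcal{A}$-supertree, that is, if and only if there exist an $\mathcal{A}$-tree $T$ and weak topological embeddings $T_1\to T$ and $T_2\to T$.
   Context: A tree is a finite directed graph that is either empty or has a distinguished root $r$ such that for every node $v$ there is exactly one directed path from $r$ to $v$. A path $v\rightsquigarrow w$ may be trivial. If there is a path $v\rightsquigarrow w$, $w$ is a descendant of $v$. Leaves have no children. Fix a set $\mathcal{A}$ of labels. An $\mathcal{A}$-tree is a tree some of whose nodes, including all leaves, are injectively labeled by elements of $\mathcal{A}$. For an $\mathcal{A}$-tree $T$: $\mathcal{A}(T)$ is the set of labels of its nodes; $v_{T,A}$ is the node labeled $A$; the cluster $\mathcal{A}_T(v)$ is the set of labels of all descendants of $v$ (including $v$); $\mathcal{C}_{\mathcal{A}}(T)=\{\mathcal{A}_T(v):v\in V(T)\}$. For $\mathcal{X}\subseteq\mathcal{A}$, the restriction $T|\mathcal{X}$ is the subtree of $T$ on the nodes $v$ with $\mathcal{A}_T(v)\cap\mathcal{X}\neq\emptyset$, a node being labeled iff it is labeled in $T$ by a label in $\mathcal{X}$, with that label. $T$ ancestrally displays $S$ if: $\mathcal{A}(S)\subseteq\mathcal{A}(T)$; for all $A,B\in\mathcal{A}(S)$ there is a path $v_{S,A}\rightsquigarrow v_{S,B}$ in $S$ iff there is a path $v_{T,A}\rightsquigarrow v_{T,B}$ in $T$; and $\mathcal{C}_{\mathcal{A}}(S)\subseteq\mathcal{C}_{\mathcal{A}}(T|\mathcal{A}(S))$.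 Two $\mathcal{A}$-trees are ancestrally compatible if there is an $\mathcal{A}$-tree that ancestrally displays both. A weak topological embedding $f:S\to T$ is a map $V(S)\to V(T)$ that is injective, preserves labels (for every $A\in\mathcal{A}(S)$, $A\in\mathcal{A}(T)$ and $f(v_{S,A})=v_{T,A}$), and preserves and reflects paths (for all $a,b\in V(S)$, there is a path $a\rightsquigarrow b$ in $S$ iff there is a path $f(a)\rightsquigarrow f(b)$ in $T$). -}

module Defs where

open import Data.Nat using (ℕ)
open import Data.Fin using (Fin)
open import Data.Bool using (Bool; true; false; T)
open import Data.Maybe using (Maybe; just; nothing)
open import Data.Product using (Σ; ∃; _×_; _,_)
open import Data.Sum using (_⊎_)
open import Relation.Binary.PropositionalEquality using (_≡_)
open import Function.Bundles using (_⇔_)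

data Path {V : Set} (E : V → V → Bool) : V → V → Set where
  here : ∀ {v} → Path E v v
  step : ∀ {u v w} → T (E u v) → Path E v w → Path E u w

-- Paths in the subgraph induced by the nodes satisfying P
-- (the start node is assumed to satisfy P; every further node must).
data PathIn {V : Set} (P : V → Set) (E : V → V → Bool) : V → V → Set where
  here : ∀ {v} → PathIn P E v v
  step : ∀ {u v w} → T (E u v) → P v → PathIn P E v w → PathIn P E u w

record ATree (A : Set) : Set where
  field
    n    : ℕ
    E    : Fin n → Fin n → Bool
    lab  : Fin n → Maybe A
    lab-injective : ∀ u v a → lab u ≡ just a → lab v ≡ just a → u ≡ v
    tree : (n ≡ 0) ⊎ (Σ (Fin n) λ r → ∀ v →
             Σ (Path E r v) λ p → ∀ (q : Path E r v) → q ≡ p)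
    leaves-labelled : ∀ v → (∀ w → E v w ≡ false) → ∃ λ a → lab v ≡ just a

open ATree public

module _ {A : Set} where

  Labels : (S : ATree A) → Fin (n S) → A → Set
  Labels S v a = lab S v ≡ just a

  LabelSet : ATree A → A → Set
  LabelSet S a = ∃ λ v → Labels S v a

  Cluster : (S : ATree A) → Fin (n S) → A → Set
  Cluster S v a = ∃ λ w → Path (E S) v w × Labels S w a

  -- Restriction T|X (X a predicate on A): the induced subgraph on the
  -- nodes v with 𝒜_T(v) ∩ X ≠ ∅, a node being labelled iff its label
  -- lies in X.
  InRestr : (S : ATree A) → (A → Set) → Fin (n S) → Set
  InRestr S X v = ∃ λ a → X a × Cluster S v a

  -- Cluster of node v (assumed in T|X) computed in T|X.
  ClusterRestr : (S : ATree A) → (A → Set) → Fin (n S) → A → Set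
  ClusterRestr S X v a =
    X a × (∃ λ w → PathIn (InRestr S X) (E S) v w × Labels S w a)

  record AncDisplays (Tr S : ATree A) : Set where
    field
      labels-⊆ : ∀ a → LabelSet S a → LabelSet Tr a
      paths-⇔  : ∀ a b (u u' : Fin (n S)) (w w' : Fin (n Tr)) →
                 Labels S u a → Labels S u' b →
                 Labels Tr w a → Labels Tr w' b →
                 Path (E S) u u' ⇔ Path (E Tr) w w'
      clusters-⊆ : ∀ (v : Fin (n S)) → Σ (Fin (n Tr)) λ w →
                   InRestr Tr (LabelSet S) w ×
                   (∀ a → Cluster S v a ⇔ ClusterRestr Tr (LabelSet S) w a)

  AncCompatible : ATree A → ATree A → Set
  AncCompatible T₁ T₂ = Σ (ATree A) λ Tr → AncDisplays Tr T₁ × AncDisplays Tr T₂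

  record WeakEmbedding (S Tr : ATree A) : Set where
    field
      f : Fin (n S) → Fin (n Tr)
      injective : ∀ u v → f u ≡ f v → u ≡ v
      labels : ∀ v a → Labels S v a → Labels Tr (f v) a
      paths : ∀ u v → Path (E S) u v ⇔ Path (E Tr) (f u) (f v)

{-# OPTIONS --safe #-}
-- If Tr ancestrally displays S, send each node v of S to lca v, the lowest common ancestor in Tr
-- of the nodes carrying the labels of the cluster of v. Then v ⇝ v' gives lca v ⇝ lca v', a strict
-- lca v < lca v' gives v ⇝ v', and a labelled node goes to the node of Tr with the same label.
-- Adding to Tr a copy of every node v of S, placed among the ancestors of lca v in the order of S,
-- gives a forest order whose Hasse diagram is a tree into which both Tr and S embed weakly.
-- Ancestral display is inherited along weak embeddings, so if Tr displays T₁ and T₂, the tree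
-- obtained for T₁ still displays T₂, and extending it once more gives a common weak supertree.
-- Conversely, a weak embedding S → Tr transports the display of S by itself to a display by Tr.
module Submission where

open import Defs
open import Level using (0ℓ)
open import Data.Bool using (Bool; true; false; T)
open import Data.Bool.Properties using (T?; T-irrelevant)
open import Data.Empty using (⊥; ⊥-elim)
open import Data.Fin using (Fin; zero; splitAt; join)
open import Data.Fin.Induction using (po-wellFounded; po-noetherian)
open import Data.Fin.Properties using (any?; all?; _≟_; ¬Fin0; splitAt-join; join-splitAt)
open import Data.Maybe using (Maybe; just; nothing)
open import Data.Nat using (ℕ; zero; suc; _+_)
open import Data.Product using (Σ; ∃; _×_; _,_; proj₁; proj₂; uncurry)
open import Data.Sum using (_⊎_; inj₁; inj₂; swap; [_,_]′)
import Data.Sum as Sum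
open import Data.Sum.Properties using (inj₁-injective)
open import Data.Unit using (⊤; tt)
open import Function using (id; flip; _∘_; case_of_)
open import Function.Bundles using (_⇔_; mk⇔; Equivalence)
open import Function.Construct.Composition using (_⇔-∘_)
open import Function.Construct.Identity using (⇔-id)
open import Function.Construct.Symmetry using (⇔-sym)
open import Function.Properties.Equivalence using (⇔-setoid)
open import Induction.WellFounded using (WellFounded; Acc; acc)
open import Relation.Binary using (Rel; IsPartialOrder)
import Relation.Binary.Construct.NonStrictToStrict as NonStrictToStrict
open import Relation.Binary.PropositionalEquality
import Relation.Binary.Reasoning.Setoid as SetoidReasoning
open import Relation.Nullary using (¬_; Dec; yes; no)
open import Relation.Nullary.Decidable
  using (map′; _→-dec_; _⊎-dec_; _×-dec_; ¬?; ⌊_⌋; toWitness; fromWitness)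

module ⇔-Reasoning = SetoidReasoning (⇔-setoid 0ℓ)

¬T⇒≡false : ∀ {b} → ¬ T b → b ≡ false
¬T⇒≡false {false} _  = refl
¬T⇒≡false {true}  ¬t = ⊥-elim (¬t _)

empty-domain : ∀ {m} → (Fin m → Fin 0) → m ≡ 0
empty-domain {zero}  _ = refl
empty-domain {suc m} f = ⊥-elim (¬Fin0 (f zero))

module _ {V : Set} {E : V → V → Bool} where

  infixr 5 _++_

  _++_ : ∀ {u v w} → Path E u v → Path E v w → Path E u w
  here     ++ q = q
  step e p ++ q = step e (p ++ q)

  step-injective : ∀ {u v v' w} {e : T (E u v)} {e' : T (E u v')} {p : Path E v w} {p' : Path E v' w} →
                   _≡_ {A = Path E u w} (step e p) (step e' p') → Σ (v ≡ v') λ { refl → p ≡ p' }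
  step-injective refl = refl , refl

  ++-cancelˡ : ∀ {u v w} (r : Path E u v) {p q : Path E v w} → r ++ p ≡ r ++ q → p ≡ q
  ++-cancelˡ here       eq = eq
  ++-cancelˡ (step e r) {p} {q} eq with step-injective {p = r ++ p} {p' = r ++ q} eq
  ... | refl , eq' = ++-cancelˡ r eq'

  ++-comparable : ∀ {r x y z} (a : Path E r x) (b : Path E x z) (c : Path E r y) (d : Path E y z) →
                  a ++ b ≡ c ++ d → Path E x y ⊎ Path E y x
  ++-comparable here        b c           d eq = inj₁ c
  ++-comparable (step e a)  b here        d eq = inj₂ (step e a)
  ++-comparable (step e a)  b (step e' c) d eq with step-injective {p = a ++ b} {p' = c ++ d} eq
  ... | refl , eq' = ++-comparable a b c d eq'

module FiniteOrder {n : ℕ} {_≼_ : Rel (Fin n) 0ℓ} (≼-isPartialOrder : IsPartialOrder _≡_ _≼_) where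

  open IsPartialOrder ≼-isPartialOrder using () renaming (refl to ≼-refl; trans to ≼-trans)
  open NonStrictToStrict _≡_ _≼_ public using (_<_)

  <-trans : ∀ {x y z} → x < y → y < z → x < z
  <-trans = NonStrictToStrict.<-trans _≡_ _≼_ ≼-isPartialOrder

  <⇒⋡ : ∀ {x y} → x < y → ¬ y ≼ x
  <⇒⋡ = NonStrictToStrict.<⇒≱ _≡_ _≼_ (IsPartialOrder.antisym ≼-isPartialOrder)

  <-wellFounded : WellFounded _<_
  <-wellFounded = po-wellFounded ≼-isPartialOrder

  <-noetherian : WellFounded (flip _<_)
  <-noetherian = po-noetherian ≼-isPartialOrder

  module Extremal (_≼?_ : ∀ x y → Dec (x ≼ y)) where

    _<?_ : ∀ x y → Dec (x < y)
    _<?_ = NonStrictToStrict.<-decidable _≡_ _≼_ _≟_ _≼?_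

    minimalBelow : (P : Fin n → Set) → (∀ x → Dec (P x)) → ∀ {x} → P x →
                   Σ (Fin n) λ y → P y × y ≼ x × (∀ {z} → z < y → ¬ P z)
    minimalBelow P P? {x} px = go px (<-wellFounded x)
      where
      go : ∀ {x} → P x → Acc _<_ x → Σ (Fin n) λ y → P y × y ≼ x × (∀ {z} → z < y → ¬ P z)
      go {x} px (acc below) with any? (λ z → z <? x ×-dec P? z)
      ... | no ∄z = x , px , ≼-refl , λ z<x pz → ∄z (_ , z<x , pz)
      ... | yes (z , z<x , pz) with go pz (below z<x)
      ...   | y , py , y≼z , minimal = y , py , ≼-trans y≼z (proj₁ z<x) , minimal

    maximalAbove : (P : Fin n → Set) → (∀ x → Dec (P x)) → ∀ {x} → P x →
                   Σ (Fin n) λ y → P y × x ≼ y × (∀ {z} → y < z → ¬ P z)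
    maximalAbove P P? {x} px = go px (<-noetherian x)
      where
      go : ∀ {x} → P x → Acc (flip _<_) x → Σ (Fin n) λ y → P y × x ≼ y × (∀ {z} → y < z → ¬ P z)
      go {x} px (acc above) with any? (λ z → x <? z ×-dec P? z)
      ... | no ∄z = x , px , ≼-refl , λ x<z pz → ∄z (_ , x<z , pz)
      ... | yes (z , x<z , pz) with go pz (above x<z)
      ...   | y , py , z≼y , maximal = y , py , ≼-trans (proj₁ x<z) z≼y , maximal

module TreeProperties {A : Set} (S : ATree A) where

  infix 4 _⇝_ _⇝?_

  _⇝_ : Fin (n S) → Fin (n S) → Set
  _⇝_ = Path (E S)

  inhabited⇒rooted : Fin (n S) → Σ (Fin (n S)) λ r → ∀ v → Σ (r ⇝ v) λ p → ∀ q → q ≡ p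
  inhabited⇒rooted x with tree S
  ... | inj₁ n≡0 = ⊥-elim (¬Fin0 (subst Fin n≡0 x))
  ... | inj₂ root = root

  ⇝-unique : ∀ {x y} (p q : x ⇝ y) → p ≡ q
  ⇝-unique {x} p q with inhabited⇒rooted x
  ... | r , pathFrom = ++-cancelˡ (proj₁ (pathFrom x))
                         (trans (proj₂ (pathFrom _) _) (sym (proj₂ (pathFrom _) _)))

  ⇝-antisym : ∀ {x y} → x ⇝ y → y ⇝ x → x ≡ y
  ⇝-antisym here       _ = refl
  ⇝-antisym (step e p) q with ⇝-unique (step e p ++ q) here
  ... | ()

  ancestors-comparable : ∀ {x y z} → x ⇝ z → y ⇝ z → x ⇝ y ⊎ y ⇝ x
  ancestors-comparable {x} {y} p q with inhabited⇒rooted x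
  ... | r , pathFrom =
    ++-comparable (proj₁ (pathFrom x)) p (proj₁ (pathFrom y)) q (⇝-unique _ _)

  ⇝-isPartialOrder : IsPartialOrder _≡_ _⇝_
  ⇝-isPartialOrder = record
    { isPreorder = record
      { isEquivalence = isEquivalence
      ; reflexive     = λ { refl → here }
      ; trans         = _++_
      }
    ; antisym = ⇝-antisym
    }

  open FiniteOrder ⇝-isPartialOrder public

  edge⇒< : ∀ {u c} → T (E S u c) → u < c
  edge⇒< e = step e here , λ { refl → case ⇝-unique (step e here) here of λ () }

  _⇝?_ : ∀ u v → Dec (u ⇝ v)
  u ⇝? v = go (<-noetherian u)
    where
    go : ∀ {u} → Acc (flip _<_) u → Dec (u ⇝ v)
    go {u} (acc above) with u ≟ v
    ... | yes refl = yes here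
    ... | no u≢v   = map′ (λ (c , e , p) → step e p) viaChild (any? viaChild?)
      where
      viaChild? : ∀ c → Dec (T (E S u c) × c ⇝ v)
      viaChild? c with T? (E S u c)
      ... | no ¬e = no (¬e ∘ proj₁)
      ... | yes e = map′ (e ,_) proj₂ (go (above (edge⇒< e)))
      viaChild : u ⇝ v → ∃ λ c → T (E S u c) × c ⇝ v
      viaChild here       = ⊥-elim (u≢v refl)
      viaChild (step e p) = _ , e , p

  cluster-nonempty : ∀ v → ∃ (Cluster S v)
  cluster-nonempty v = go (<-noetherian v)
    where
    go : ∀ {v} → Acc (flip _<_) v → ∃ (Cluster S v)
    go {v} (acc above) with lab S v in eq | any? (λ c → T? (E S v c))
    ... | just a  | _           = a , v , here , eq
    ... | nothing | yes (c , e) with go (above (edge⇒< e))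
    ...   | a , ℓ , p , l = a , ℓ , step e p , l
    go {v} _ | nothing | no leaf with leaves-labelled S v (λ c → ¬T⇒≡false (λ e → leaf (c , e)))
    ...   | a , l with trans (sym eq) l
    ...     | ()

module _ {A : Set} where

  labelled-unique : (S : ATree A) {u v : Fin (n S)} {a : A} → Labels S u a → Labels S v a → u ≡ v
  labelled-unique S = lab-injective S _ _ _

  cluster⊆labels : (S : ATree A) {v : Fin (n S)} {a : A} → Cluster S v a → LabelSet S a
  cluster⊆labels S (w , _ , l) = w , l

  clusterRestr⇔ : (S : ATree A) (X : A → Set) → ∀ v a → ClusterRestr S X v a ⇔ (X a × Cluster S v a)
  clusterRestr⇔ S X v a =
    mk⇔ (λ (xa , w , p , l) → xa , w , forget p , l) (λ (xa , w , p , l) → xa , w , restrict xa l p , l)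
    where
    forget : ∀ {u w} → PathIn (InRestr S X) (E S) u w → Path (E S) u w
    forget here         = here
    forget (step e _ p) = step e (forget p)
    restrict : ∀ {u w} → X a → Labels S w a → Path (E S) u w → PathIn (InRestr S X) (E S) u w
    restrict xa l here       = here
    restrict xa l (step e p) = step e (a , xa , _ , p , l) (restrict xa l p)

  mkWeakEmbedding : {S T : ATree A} (f : Fin (n S) → Fin (n T)) →
                    (∀ v a → Labels S v a → Labels T (f v) a) →
                    (∀ u v → Path (E S) u v ⇔ Path (E T) (f u) (f v)) → WeakEmbedding S T
  mkWeakEmbedding {S} {T} f labels paths = record
    { f         = f
    ; injective = λ u v fu≡fv → ⇝-antisym (reflect u v fu≡fv) (reflect v u (sym fu≡fv))
    ; labels    = labels
    ; paths     = paths
    }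
    where
    open TreeProperties S using (⇝-antisym)
    reflect : ∀ u v → f u ≡ f v → Path (E S) u v
    reflect u v fu≡fv = Equivalence.from (paths u v) (subst (Path (E T) (f u)) fu≡fv here)

  _∘ₑ_ : {R S T : ATree A} → WeakEmbedding S T → WeakEmbedding R S → WeakEmbedding R T
  ι ∘ₑ κ = mkWeakEmbedding (ι.f ∘ κ.f) (λ v a → ι.labels (κ.f v) a ∘ κ.labels v a)
                            (λ u v → ι.paths (κ.f u) (κ.f v) ⇔-∘ κ.paths u v)
    where module ι = WeakEmbedding ι
          module κ = WeakEmbedding κ

  module _ {S T : ATree A} (ι : WeakEmbedding S T) where
    open WeakEmbedding ι

    cluster-image : ∀ {v a} → Cluster S v a → Cluster T (f v) a
    cluster-image (w , p , l) = f w , Equivalence.to (paths _ w) p , labels w _ l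

    cluster-preimage : ∀ {v a} → LabelSet S a → Cluster T (f v) a → Cluster S v a
    cluster-preimage (ℓ , l) (w , p , l') with labelled-unique T l' (labels ℓ _ l)
    ... | refl = ℓ , Equivalence.from (paths _ ℓ) p , l

  displays-refl : (S : ATree A) → AncDisplays S S
  displays-refl S = record
    { labels-⊆   = λ _ → id
    ; paths-⇔    = paths
    ; clusters-⊆ = λ v → v , inRestr v ,
                   λ a → ⇔-sym (clusterRestr⇔ S (LabelSet S) v a)
                         ⇔-∘ mk⇔ (λ c → cluster⊆labels S c , c) proj₂
    }
    where
    inRestr : ∀ v → InRestr S (LabelSet S) v
    inRestr v with TreeProperties.cluster-nonempty S v
    ... | a , c = a , cluster⊆labels S c , c
    paths : ∀ a b u u' w w' → Labels S u a → Labels S u' b → Labels S w a → Labels S w' b →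
            Path (E S) u u' ⇔ Path (E S) w w'
    paths a b u u' w w' lu lu' lw lw' with labelled-unique S lu lw | labelled-unique S lu' lw'
    ... | refl | refl = ⇔-id _

  displays-along : {S T T' : ATree A} → WeakEmbedding T T' → AncDisplays T S → AncDisplays T' S
  displays-along {S} {T} {T'} ι D = record
    { labels-⊆   = λ a → image ∘ labels-⊆ a
    ; paths-⇔    = paths
    ; clusters-⊆ = clusters
    }
    where
    open AncDisplays D
    open ⇔-Reasoning
    module ι = WeakEmbedding ι
    X : A → Set
    X = LabelSet S
    image : ∀ {a} → LabelSet T a → LabelSet T' a
    image (w , l) = ι.f w , ι.labels w _ l
    paths : ∀ a b u u' w w' → Labels S u a → Labels S u' b → Labels T' w a → Labels T' w' b →
            Path (E S) u u' ⇔ Path (E T') w w'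
    paths a b u u' w w' lu lu' lw lw' with labels-⊆ a (u , lu) | labels-⊆ b (u' , lu')
    ... | x , lx | x' , lx'
        with labelled-unique T' (ι.labels x a lx) lw | labelled-unique T' (ι.labels x' b lx') lw'
    ... | refl | refl = ι.paths x x' ⇔-∘ paths-⇔ a b u u' x x' lu lu' lx lx'
    transport : ∀ w a → (X a × Cluster T w a) ⇔ (X a × Cluster T' (ι.f w) a)
    transport w a = mk⇔ (λ (xa , c) → xa , cluster-image ι c)
                        (λ (xa , c) → xa , cluster-preimage ι (labels-⊆ a xa) c)
    clusters : ∀ v → Σ (Fin (n T')) λ w' →
               InRestr T' X w' × (∀ a → Cluster S v a ⇔ ClusterRestr T' X w' a)
    clusters v with clusters-⊆ v
    ... | w , (a , xa , c) , cluster⇔ =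
      ι.f w , (a , xa , cluster-image ι c) , λ a → begin
        Cluster S v a                     ≈⟨ cluster⇔ a ⟩
        ClusterRestr T X w a              ≈⟨ clusterRestr⇔ T X w a ⟩
        (X a × Cluster T w a)             ≈⟨ transport w a ⟩
        (X a × Cluster T' (ι.f w) a)      ≈⟨ clusterRestr⇔ T' X (ι.f w) a ⟨
        ClusterRestr T' X (ι.f w) a       ∎

  embedding⇒displays : {S T : ATree A} → WeakEmbedding S T → AncDisplays T S
  embedding⇒displays {S} ι = displays-along ι (displays-refl S)

module HasseDiagram {N : ℕ} {_≼_ : Rel (Fin N) 0ℓ} (≼-isPartialOrder : IsPartialOrder _≡_ _≼_)
                    (_≼?_ : ∀ x y → Dec (x ≼ y))
                    (≼-chain : ∀ {x y z} → x ≼ z → y ≼ z → x ≼ y ⊎ y ≼ x) where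

  open IsPartialOrder ≼-isPartialOrder using () renaming (refl to ≼-refl; trans to ≼-trans)
  open FiniteOrder ≼-isPartialOrder
  open Extremal _≼?_

  _⋖_ : Fin N → Fin N → Set
  x ⋖ y = x < y × ¬ (∃ λ z → x < z × z < y)

  _⋖?_ : ∀ x y → Dec (x ⋖ y)
  x ⋖? y = (x <? y) ×-dec ¬? (any? λ z → (x <? z) ×-dec (z <? y))

  cover : Fin N → Fin N → Bool
  cover x y = ⌊ x ⋖? y ⌋

  cover⇒⋖ : ∀ {x y} → T (cover x y) → x ⋖ y
  cover⇒⋖ = toWitness

  path⇒≼ : ∀ {x y} → Path cover x y → x ≼ y
  path⇒≼ here       = ≼-refl
  path⇒≼ (step e p) = ≼-trans (proj₁ (proj₁ (cover⇒⋖ e))) (path⇒≼ p)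

  cover-towards : ∀ {x y} → x < y → ∃ λ c → T (cover x c) × c ≼ y
  cover-towards {x} x<y with minimalBelow (x <_) (x <?_) x<y
  ... | c , x<c , c≼y , minimal = c , fromWitness (x<c , λ (z , x<z , z<c) → minimal z<c x<z) , c≼y

  ≼⇒path : ∀ {x y} → x ≼ y → Path cover x y
  ≼⇒path {x} {y} x≼y = go (<-noetherian x) x≼y
    where
    go : ∀ {x} → Acc (flip _<_) x → x ≼ y → Path cover x y
    go {x} (acc above) x≼y with x ≟ y
    ... | yes refl = here
    ... | no x≢y with cover-towards (x≼y , x≢y)
    ...   | c , e , c≼y = step e (go (above (proj₁ (cover⇒⋖ e))) c≼y)

  path⇔≼ : ∀ {x y} → Path cover x y ⇔ x ≼ y
  path⇔≼ = mk⇔ path⇒≼ ≼⇒path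

  covers-comparable⇒≡ : ∀ {x c d} → T (cover x c) → T (cover x d) → c ≼ d ⊎ d ≼ c → c ≡ d
  covers-comparable⇒≡ {c = c} {d} e e' c≼d⊎d≼c with c ≟ d
  ... | yes c≡d = c≡d
  ... | no c≢d with c≼d⊎d≼c
  ...   | inj₁ c≼d = ⊥-elim (proj₂ (cover⇒⋖ e') (c , proj₁ (cover⇒⋖ e) , c≼d , c≢d))
  ...   | inj₂ d≼c = ⊥-elim (proj₂ (cover⇒⋖ e) (d , proj₁ (cover⇒⋖ e') , d≼c , c≢d ∘ sym))

  path-unique : ∀ {x y} (p q : Path cover x y) → p ≡ q
  path-unique here       here         = refl
  path-unique here       (step e q)   = ⊥-elim (<⇒⋡ (proj₁ (cover⇒⋖ e)) (path⇒≼ q))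
  path-unique (step e p) here         = ⊥-elim (<⇒⋡ (proj₁ (cover⇒⋖ e)) (path⇒≼ p))
  path-unique (step e p) (step e' q) with covers-comparable⇒≡ e e' (≼-chain (path⇒≼ p) (path⇒≼ q))
  ... | refl = cong₂ step (T-irrelevant e e') (path-unique p q)

  least⇒rooted : ∀ {ρ} → (∀ v → ρ ≼ v) → ∀ v → Σ (Path cover ρ v) λ p → ∀ q → q ≡ p
  least⇒rooted ρ≼ v = ≼⇒path (ρ≼ v) , λ q → path-unique q _

  no-cover⇒maximal : ∀ {x} → (∀ y → cover x y ≡ false) → ∀ {y} → x ≼ y → x ≡ y
  no-cover⇒maximal {x} no-cover {y} x≼y with x ≟ y
  ... | yes x≡y = x≡y
  ... | no x≢y with cover-towards (x≼y , x≢y)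
  ...   | c , e , _ = ⊥-elim (subst T (no-cover c) e)

module LowestCommonAncestor {A : Set} (Tr S : ATree A) (D : AncDisplays Tr S) where

  open AncDisplays D
  private
    module Tr = TreeProperties Tr
    module S  = TreeProperties S

  CommonAncestor : Fin (n S) → Fin (n Tr) → Set
  CommonAncestor v y = ∀ {a s} → Cluster S v a → Labels Tr s a → y Tr.⇝ s

  commonAncestor? : ∀ v y → Dec (CommonAncestor v y)
  commonAncestor? v y =
    map′ (λ h (ℓ , p , l) → h ℓ p l) (λ h ℓ {a} {s} p l → h (ℓ , p , l)) (all? ancestorOfImage?)
    where
    ancestorOfImage? : ∀ ℓ → Dec (∀ {a s} → v S.⇝ ℓ → lab S ℓ ≡ just a → Labels Tr s a → y Tr.⇝ s)
    ancestorOfImage? ℓ with lab S ℓ in eq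
    ... | nothing = yes λ _ ()
    ... | just a with labels-⊆ a (ℓ , eq)
    ...   | s , l = map′ (λ h p → λ { refl l' → subst (y Tr.⇝_) (labelled-unique Tr l l') (h p) })
                         (λ h p → h p refl l)
                         (v S.⇝? ℓ →-dec y Tr.⇝? s)

  anchor : Fin (n S) → Fin (n Tr)
  anchor v = proj₁ (clusters-⊆ v)

  cluster⇔ : ∀ v a → Cluster S v a ⇔ (LabelSet S a × Cluster Tr (anchor v) a)
  cluster⇔ v a = clusterRestr⇔ Tr (LabelSet S) (anchor v) a ⇔-∘ proj₂ (proj₂ (clusters-⊆ v)) a

  anchor-common : ∀ v → CommonAncestor v (anchor v)
  anchor-common v {a} c l with Equivalence.to (cluster⇔ v a) c
  ... | _ , w , p , l' with labelled-unique Tr l' l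
  ...   | refl = p

  lca-spec : ∀ v → Σ (Fin (n Tr)) λ y →
             CommonAncestor v y × anchor v Tr.⇝ y × (∀ {z} → y Tr.< z → ¬ CommonAncestor v z)
  lca-spec v = Tr.Extremal.maximalAbove Tr._⇝?_ (CommonAncestor v) (commonAncestor? v) (anchor-common v)

  lca : Fin (n S) → Fin (n Tr)
  lca v = proj₁ (lca-spec v)

  lca-common : ∀ v → CommonAncestor v (lca v)
  lca-common v = proj₁ (proj₂ (lca-spec v))

  anchor⇝lca : ∀ v → anchor v Tr.⇝ lca v
  anchor⇝lca v = proj₁ (proj₂ (proj₂ (lca-spec v)))

  lca-maximal : ∀ {v z} → lca v Tr.< z → ¬ CommonAncestor v z
  lca-maximal {v} = proj₂ (proj₂ (proj₂ (lca-spec v)))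

  lca-lowest : ∀ {v y} → CommonAncestor v y → y Tr.⇝ lca v
  lca-lowest {v} {y} common with S.cluster-nonempty v
  ... | a , c with labels-⊆ a (cluster⊆labels S c)
  ...   | s , l with Tr.ancestors-comparable (common c l) (lca-common v c l)
  ...     | inj₁ y⇝lca = y⇝lca
  ...     | inj₂ lca⇝y with lca v ≟ y
  ...       | yes refl = here
  ...       | no lca≢y = ⊥-elim (lca-maximal (lca⇝y , lca≢y) common)

  cluster-lca : ∀ {v a s} → lca v Tr.⇝ s → Labels Tr s a → LabelSet S a → Cluster S v a
  cluster-lca {v} {a} {s} p l xa = Equivalence.from (cluster⇔ v a) (xa , s , anchor⇝lca v ++ p , l)

  lca-mono : ∀ {v v'} → v S.⇝ v' → lca v Tr.⇝ lca v'
  lca-mono q = lca-lowest λ (ℓ , p , l) → lca-common _ (ℓ , q ++ p , l)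

  lca-labelled : ∀ {v a} → Labels S v a → Labels Tr (lca v) a
  lca-labelled {v} {a} l with labels-⊆ a (v , l)
  ... | s , ls = subst (λ w → Labels Tr w a) s≡lca ls
    where
    s≡lca : s ≡ lca v
    s-common : CommonAncestor v s
    s-common {b} {s'} (ℓ , p , lℓ) ls' = Equivalence.to (paths-⇔ a b v ℓ s s' l lℓ ls ls') p
    s≡lca = Tr.⇝-antisym (lca-lowest s-common) (lca-common v (v , here , l) ls)

  ⇝labelled⇔lca : ∀ {v v' a} → Labels S v a → v' S.⇝ v ⇔ lca v' Tr.⇝ lca v
  ⇝labelled⇔lca {v} l = mk⇔ lca-mono from
    where
    from : ∀ {v'} → lca v' Tr.⇝ lca v → v' S.⇝ v
    from q with cluster-lca q (lca-labelled l) (v , l)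
    ... | ℓ , p , l' with labelled-unique S l' l
    ...   | refl = p

  lca-comparable : ∀ {v v'} → lca v Tr.⇝ lca v' → v S.⇝ v' ⊎ v' S.⇝ v
  lca-comparable {v} {v'} q with S.cluster-nonempty v'
  ... | a , c@(ℓ , p , l) with labels-⊆ a (ℓ , l)
  ...   | s , ls with cluster-lca (q ++ lca-common v' c ls) ls (ℓ , l)
  ...     | ℓ' , p' , l' with labelled-unique S l' l
  ...       | refl = S.ancestors-comparable p' p

  lca-strict : ∀ {v v'} → lca v Tr.⇝ lca v' → lca v ≢ lca v' → v S.⇝ v'
  lca-strict q lca≢ with lca-comparable q
  ... | inj₁ p = p
  ... | inj₂ p = ⊥-elim (lca≢ (Tr.⇝-antisym q (lca-mono p)))

module Extension {A : Set} (Tr S : ATree A) (D : AncDisplays Tr S) where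

  open LowestCommonAncestor Tr S D
  private
    module Tr = TreeProperties Tr
    module S  = TreeProperties S

  Node : Set
  Node = Fin (n Tr) ⊎ Fin (n S)

  base : Node → Fin (n Tr)
  base (inj₁ w) = w
  base (inj₂ v) = lca v

  infix 4 _⊑_ _≤_

  -- The copies of the nodes of S lying over w become ancestors of w, ordered among themselves as in S.
  _⊑_ : Node → Node → Set
  inj₁ _ ⊑ inj₁ _  = ⊤
  inj₁ _ ⊑ inj₂ _  = ⊥
  inj₂ _ ⊑ inj₁ _  = ⊤
  inj₂ v ⊑ inj₂ v' = v S.⇝ v'

  _⊑?_ : ∀ x y → Dec (x ⊑ y)
  inj₁ _ ⊑? inj₁ _  = yes tt
  inj₁ _ ⊑? inj₂ _  = no λ ()
  inj₂ _ ⊑? inj₁ _  = yes tt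
  inj₂ v ⊑? inj₂ v' = v S.⇝? v'

  ⊑-refl : ∀ x → x ⊑ x
  ⊑-refl (inj₁ _) = tt
  ⊑-refl (inj₂ _) = here

  ⊑-trans : ∀ x y z → x ⊑ y → y ⊑ z → x ⊑ z
  ⊑-trans (inj₁ _) (inj₁ _) (inj₁ _) _ _ = tt
  ⊑-trans (inj₂ _) (inj₁ _) (inj₁ _) _ _ = tt
  ⊑-trans (inj₂ _) (inj₂ _) (inj₁ _) _ _ = tt
  ⊑-trans (inj₂ _) (inj₂ _) (inj₂ _) p q = p ++ q
  ⊑-trans (inj₁ _) (inj₂ _) _        () _
  ⊑-trans (inj₁ _) (inj₁ _) (inj₂ _) _ ()
  ⊑-trans (inj₂ _) (inj₁ _) (inj₂ _) _ ()

  ⊑-antisym : ∀ x y → base x ≡ base y → x ⊑ y → y ⊑ x → x ≡ y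
  ⊑-antisym (inj₁ _) (inj₁ _) refl _ _ = refl
  ⊑-antisym (inj₂ _) (inj₂ _) _    p q = cong inj₂ (S.⇝-antisym p q)
  ⊑-antisym (inj₁ _) (inj₂ _) _    () _
  ⊑-antisym (inj₂ _) (inj₁ _) _    _ ()

  ⊑-total : ∀ x y → base x ≡ base y → x ⊑ y ⊎ y ⊑ x
  ⊑-total (inj₁ _) (inj₁ _) _ = inj₁ tt
  ⊑-total (inj₁ _) (inj₂ _) _ = inj₂ tt
  ⊑-total (inj₂ _) (inj₁ _) _ = inj₁ tt
  ⊑-total (inj₂ v) (inj₂ _) eq = lca-comparable (subst (lca v Tr.⇝_) eq here)

  data _≤_ (x y : Node) : Set where
    below  : base x Tr.< base y → x ≤ y
    beside : base x ≡ base y → x ⊑ y → x ≤ y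

  _≤?_ : ∀ x y → Dec (x ≤ y)
  x ≤? y = map′ [ below , uncurry beside ]′ split
             (Tr.Extremal._<?_ Tr._⇝?_ (base x) (base y) ⊎-dec ((base x ≟ base y) ×-dec (x ⊑? y)))
    where
    split : x ≤ y → base x Tr.< base y ⊎ (base x ≡ base y × x ⊑ y)
    split (below p)     = inj₁ p
    split (beside eq c) = inj₂ (eq , c)

  ≤⇒⇝ : ∀ {x y} → x ≤ y → base x Tr.⇝ base y
  ≤⇒⇝     (below (p , _)) = p
  ≤⇒⇝ {x} (beside eq _)   = subst (base x Tr.⇝_) eq here

  ≤-intro : ∀ {x y} → base x Tr.⇝ base y → (base x ≡ base y → x ⊑ y) → x ≤ y
  ≤-intro {x} {y} p same with base x ≟ base y
  ... | yes eq = beside eq (same eq)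
  ... | no neq = below (p , neq)

  ≤-refl : ∀ x → x ≤ x
  ≤-refl x = beside refl (⊑-refl x)

  ≤-trans : ∀ {x y z} → x ≤ y → y ≤ z → x ≤ z
  ≤-trans             (below p)     (below q)      = below (Tr.<-trans p q)
  ≤-trans {x}         (below p)     (beside eq _)  = below (subst (base x Tr.<_) eq p)
  ≤-trans {z = z}     (beside eq _) (below q)      = below (subst (Tr._< base z) (sym eq) q)
  ≤-trans {x} {y} {z} (beside eq c) (beside eq' c') = beside (trans eq eq') (⊑-trans x y z c c')

  ≤-antisym : ∀ {x y} → x ≤ y → y ≤ x → x ≡ y
  ≤-antisym         (below (p , neq)) q                 = ⊥-elim (neq (Tr.⇝-antisym p (≤⇒⇝ q)))
  ≤-antisym         p                 (below (q , neq)) = ⊥-elim (neq (Tr.⇝-antisym q (≤⇒⇝ p)))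
  ≤-antisym {x} {y} (beside eq c)     (beside _ c')     = ⊑-antisym x y eq c c'

  ≤-comparable : ∀ {x y} → base x Tr.⇝ base y → x ≤ y ⊎ y ≤ x
  ≤-comparable {x} {y} p with base x ≟ base y
  ... | no neq = inj₁ (below (p , neq))
  ... | yes eq = Sum.map (beside eq) (beside (sym eq)) (⊑-total x y eq)

  ≤-chain : ∀ {x y z} → x ≤ z → y ≤ z → x ≤ y ⊎ y ≤ x
  ≤-chain p q with Tr.ancestors-comparable (≤⇒⇝ p) (≤⇒⇝ q)
  ... | inj₁ bx⇝by = ≤-comparable bx⇝by
  ... | inj₂ by⇝bx = swap (≤-comparable by⇝bx)

  ≤inj₁⇔ : ∀ x w → x ≤ inj₁ w ⇔ base x Tr.⇝ w
  ≤inj₁⇔ x w = mk⇔ ≤⇒⇝ (λ p → ≤-intro p (λ _ → ⊑inj₁ x))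
    where
    ⊑inj₁ : ∀ x → x ⊑ inj₁ w
    ⊑inj₁ (inj₁ _) = tt
    ⊑inj₁ (inj₂ _) = tt

  N : ℕ
  N = n Tr + n S

  node : Fin N → Node
  node = splitAt (n Tr)

  index : Node → Fin N
  index = join (n Tr) (n S)

  node-index : ∀ x → node (index x) ≡ x
  node-index = splitAt-join (n Tr) (n S)

  node-injective : ∀ {i j} → node i ≡ node j → i ≡ j
  node-injective {i} {j} eq =
    trans (sym (join-splitAt (n Tr) (n S) i)) (trans (cong index eq) (join-splitAt (n Tr) (n S) j))

  _≼_ : Fin N → Fin N → Set
  i ≼ j = node i ≤ node j

  ≼-isPartialOrder : IsPartialOrder _≡_ _≼_
  ≼-isPartialOrder = record
    { isPreorder = record
      { isEquivalence = isEquivalence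
      ; reflexive     = λ { {i} refl → ≤-refl (node i) }
      ; trans         = ≤-trans
      }
    ; antisym = λ p q → node-injective (≤-antisym p q)
    }

  _≼?_ : ∀ i j → Dec (i ≼ j)
  i ≼? j = node i ≤? node j

  open HasseDiagram ≼-isPartialOrder _≼?_ ≤-chain
  open FiniteOrder.Extremal ≼-isPartialOrder _≼?_ using (minimalBelow)

  label : Node → Maybe A
  label (inj₁ w) = lab Tr w
  label (inj₂ _) = nothing

  label-injective : ∀ x y a → label x ≡ just a → label y ≡ just a → x ≡ y
  label-injective (inj₁ w) (inj₁ w') a l l' = cong inj₁ (lab-injective Tr w w' a l l')
  label-injective (inj₂ _) _        _ ()
  label-injective (inj₁ _) (inj₂ _) _ _ ()

  maximal-labelled : ∀ x → (∀ {y} → x ≤ y → x ≡ y) → ∃ λ a → label x ≡ just a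
  maximal-labelled (inj₁ w) maximal = leaves-labelled Tr w λ c → ¬T⇒≡false λ e →
    proj₂ (Tr.edge⇒< e) (inj₁-injective (maximal (below (Tr.edge⇒< e))))
  maximal-labelled (inj₂ v) maximal with maximal {inj₁ (lca v)} (≤-intro here (λ _ → tt))
  ... | ()

  -- A minimal node lies over the root of Tr, and the nodes over the root form a chain.
  least-element : ∀ r → (∀ w → r Tr.⇝ w) → Σ (Fin N) λ ρ → ∀ j → ρ ≼ j
  least-element r r⇝ with minimalBelow (λ _ → ⊤) (λ _ → yes tt) {index (inj₁ r)} tt
  ... | ρ , _ , ρ≼r , minimal = ρ , least
    where
    base-ρ : base (node ρ) ≡ r
    base-ρ = Tr.⇝-antisym (≤⇒⇝ (subst (node ρ ≤_) (node-index (inj₁ r)) ρ≼r)) (r⇝ _)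
    least : ∀ j → ρ ≼ j
    least j with ≤-comparable {node ρ} {node j} (subst (Tr._⇝ base (node j)) (sym base-ρ) (r⇝ _))
    ... | inj₁ ρ≤j = ρ≤j
    ... | inj₂ j≤ρ with j ≟ ρ
    ...   | yes refl = ≤-refl (node j)
    ...   | no j≢ρ   = ⊥-elim (minimal (j≤ρ , j≢ρ) tt)

  extension : ATree A
  extension = record
    { n               = N
    ; E               = cover
    ; lab             = label ∘ node
    ; lab-injective   = λ i j a l l' → node-injective (label-injective (node i) (node j) a l l')
    ; tree            = rootedness
    ; leaves-labelled = λ i no-cover → maximal-labelled (node i) (maximal no-cover)
    }
    where
    maximal : ∀ {i} → (∀ j → cover i j ≡ false) → ∀ {y} → node i ≤ y → node i ≡ y
    maximal {i} no-cover {y} i≤y =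
      trans (cong node (no-cover⇒maximal no-cover (subst (node i ≤_) (sym (node-index y)) i≤y))) (node-index y)
    rootedness : (N ≡ 0) ⊎ Σ (Fin N) λ ρ → ∀ v → Σ (Path cover ρ v) λ p → ∀ q → q ≡ p
    rootedness with tree Tr
    ... | inj₁ nTr≡0     = inj₁ (cong₂ _+_ nTr≡0 (empty-domain (subst Fin nTr≡0 ∘ lca)))
    ... | inj₂ (r , r⇝) with least-element r (proj₁ ∘ r⇝)
    ...   | ρ , least = inj₂ (ρ , least⇒rooted least)

  path-index⇔ : ∀ {x y} → Path cover (index x) (index y) ⇔ x ≤ y
  path-index⇔ {x} {y} =
    subst₂ (λ x' y' → Path cover (index x) (index y) ⇔ x' ≤ y') (node-index x) (node-index y) path⇔≼

  labels-index : ∀ {x a} → label x ≡ just a → Labels extension (index x) a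
  labels-index {x} {a} = subst (λ x' → label x' ≡ just a) (sym (node-index x))

  Tr↪extension : WeakEmbedding Tr extension
  Tr↪extension = mkWeakEmbedding (index ∘ inj₁) (λ _ _ → labels-index)
                                 (λ w w' → ⇔-sym path-index⇔ ⇔-∘ ⇔-sym (≤inj₁⇔ (inj₁ w) w'))

  labelled? : ∀ v → Dec (∃ λ a → lab S v ≡ just a)
  labelled? v with lab S v
  ... | just a  = yes (a , refl)
  ... | nothing = no λ ()

  embed : ∀ v → Dec (∃ (Labels S v)) → Node
  embed v (yes _) = inj₁ (lca v)
  embed v (no _)  = inj₂ v

  embed-paths : ∀ u v du dv → u S.⇝ v ⇔ embed u du ≤ embed v dv
  embed-paths u v (yes _) (yes (_ , l)) = ⇔-sym (≤inj₁⇔ (inj₁ (lca u)) (lca v)) ⇔-∘ ⇝labelled⇔lca l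
  embed-paths u v (no _)  (yes (_ , l)) = ⇔-sym (≤inj₁⇔ (inj₂ u) (lca v)) ⇔-∘ ⇝labelled⇔lca l
  embed-paths u v (yes (a , l)) (no ¬l) = mk⇔ to from
    where
    to : u S.⇝ v → inj₁ (lca u) ≤ inj₂ v
    to p = ≤-intro (lca-mono p) λ eq →
      ¬l (a , subst (λ w → Labels S w a)
                    (S.⇝-antisym p (Equivalence.from (⇝labelled⇔lca l) (subst (Tr._⇝ lca u) eq here))) l)
    from : inj₁ (lca u) ≤ inj₂ v → u S.⇝ v
    from (below (q , neq)) = lca-strict q neq
  embed-paths u v (no _) (no _) = mk⇔ (λ p → ≤-intro (lca-mono p) (λ _ → p)) from
    where
    from : inj₂ u ≤ inj₂ v → u S.⇝ v
    from (below (q , neq)) = lca-strict q neq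
    from (beside _ p)      = p

  S↪extension : WeakEmbedding S extension
  S↪extension = mkWeakEmbedding (λ v → index (embed v (labelled? v))) labels
                                (λ u v → ⇔-sym path-index⇔ ⇔-∘ embed-paths u v (labelled? u) (labelled? v))
    where
    labels : ∀ v a → Labels S v a → Labels extension (index (embed v (labelled? v))) a
    labels v a l with labelled? v
    ... | yes _ = labels-index (lca-labelled l)
    ... | no ¬l = ⊥-elim (¬l (a , l))

module _ {A : Set} where

  CommonWeakSupertree : ATree A → ATree A → Set
  CommonWeakSupertree T₁ T₂ = Σ (ATree A) λ Tr → WeakEmbedding T₁ Tr × WeakEmbedding T₂ Tr

  displays⇒commonWeakSupertree : {Tr S : ATree A} → AncDisplays Tr S → CommonWeakSupertree Tr S
  displays⇒commonWeakSupertree {Tr} {S} D = extension , Tr↪extension , S↪extension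
    where open Extension Tr S D

proposition2 : {A : Set} (T₁ T₂ : ATree A) →
    AncCompatible T₁ T₂ ⇔ Σ (ATree A) (λ Tr → WeakEmbedding T₁ Tr × WeakEmbedding T₂ Tr)
proposition2 T₁ T₂ = mk⇔ supertree compatible
  where
  supertree : AncCompatible T₁ T₂ → CommonWeakSupertree T₁ T₂
  supertree (Tr , D₁ , D₂) with displays⇒commonWeakSupertree D₁
  ... | Tr₁ , Tr↪Tr₁ , T₁↪Tr₁ with displays⇒commonWeakSupertree (displays-along Tr↪Tr₁ D₂)
  ...   | Tr₂ , Tr₁↪Tr₂ , T₂↪Tr₂ = Tr₂ , Tr₁↪Tr₂ ∘ₑ T₁↪Tr₁ , T₂↪Tr₂
  compatible : CommonWeakSupertree T₁ T₂ → AncCompatible T₁ T₂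
  compatible (Tr , ι₁ , ι₂) = Tr , embedding⇒displays ι₁ , embedding⇒displays ι₂
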